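{- Let $k$ be a positive integer and suppose that every nice subset of $\mathbb{Z}$ of size $k$ admits an Alspach ordering. Then for every integer $n\geq 2$, every nice subset of $\mathbb{Z}^n$ of size $k$ admits an Alspach ordering.
   Context: A finite subset $A$ of an abelian group $G$ is called nice if $0_G\notin A$ and $\sum_{z\in A} z\neq 0_G$. For a finite subset $A=\{x_1,\dots,x_k\}$ of $G$ and an ordering $\omega=(x_{j_1},\dots,x_{j_k})$ of its elements, the partial sums are $s_i(\omega)=x_{j_1}+\dots+x_{j_i}$ for $i=1,\dots,k$. An ordering $\omega$ of $A$ is called an Alspach ordering if $s_i(\omega)\neq 0_G$ for all $i$ and $s_i(\omega)\neq s_j(\omega)$ for all $1\le i<j\le k$. -}

module Defs where

open import Data.Nat using (ℕ)
open import Data.Integer as ℤ using (ℤ)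
open import Data.Vec as Vec using (Vec; zipWith; replicate)
open import Data.List using (List; []; _∷_; length; map)
open import Data.List.Membership.Propositional using (_∈_; _∉_)
open import Data.List.Relation.Unary.All using (All)
open import Data.List.Relation.Unary.Unique.Propositional using (Unique)
open import Data.List.Relation.Binary.Permutation.Propositional using (_↭_)
open import Data.Product using (Σ; _×_)
open import Relation.Binary.PropositionalEquality using (_≡_; _≢_)

-- An abelian group is represented here only through its zero and addition
-- (the groups used are the concrete groups ℤ and ℤⁿ below).

module _ {A : Set} (0# : A) (_+_ : A → A → A) where

  lsum : List A → A
  lsum []       = 0#
  lsum (x ∷ xs) = x + lsum xs

  partialSumsFrom : A → List A → List A
  partialSumsFrom acc []       = []
  partialSumsFrom acc (x ∷ xs) = (acc + x) ∷ partialSumsFrom (acc + x) xs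

  partialSums : List A → List A
  partialSums = partialSumsFrom 0#

  -- A finite subset A of G is represented by a duplicate-free list xs.
  -- Nice: 0 ∉ A and Σ A ≠ 0.
  Nice : List A → Set
  Nice xs = (0# ∉ xs) × (lsum xs ≢ 0#)

  IsAlspachOrdering : List A → List A → Set
  IsAlspachOrdering xs ys =
    (ys ↭ xs) × All (λ s → s ≢ 0#) (partialSums ys) × Unique (partialSums ys)

  HasAlspachOrdering : List A → Set
  HasAlspachOrdering xs = Σ (List A) (IsAlspachOrdering xs)

  AllNiceAdmitAlspach : ℕ → Set
  AllNiceAdmitAlspach k =
    (xs : List A) → Unique xs → length xs ≡ k → Nice xs → HasAlspachOrdering xs

AllNiceAdmitAlspachℤ : ℕ → Set
AllNiceAdmitAlspachℤ = AllNiceAdmitAlspach (ℤ.+ 0) ℤ._+_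

zeroⁿ : (n : ℕ) → Vec ℤ n
zeroⁿ n = replicate n (ℤ.+ 0)

_+ⁿ_ : {n : ℕ} → Vec ℤ n → Vec ℤ n → Vec ℤ n
_+ⁿ_ = zipWith ℤ._+_

AllNiceAdmitAlspachℤⁿ : ℕ → ℕ → Set
AllNiceAdmitAlspachℤⁿ n = AllNiceAdmitAlspach (zeroⁿ n) (_+ⁿ_ {n})

-- Any finite set of vectors in ℤⁿ is mapped injectively into ℤ by some group
-- homomorphism u ↦ u₁ + t₁ (u₂ + t₂ (u₃ + …)): read u as the digits of an
-- integer in a mixed radix whose bases tᵢ exceed all differences of entries.
-- Take one that is injective on {0, Σ A} ∪ A: it sends the nice set A to a
-- nice set of integers of the same size.  Since a homomorphism commutes with
-- partial sums, the preimage of an Alspach ordering of the image is an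
-- Alspach ordering of A.
module Submission where

open import Defs
open import Data.Nat as ℕ using (ℕ; _≤_)
import Data.Nat.Properties as ℕ
open import Data.Integer as ℤ using (ℤ; +_; ∣_∣; _-_)
import Data.Integer.Properties as ℤ
open import Data.Integer.Tactic.RingSolver using (solve-∀)
open import Data.Vec using (Vec; []; _∷_; head; tail)
open import Data.List using (List; []; _∷_; map)
open import Data.List.Properties using (length-map)
open import Data.List.Extrema.Nat using (max; xs≤max)
open import Data.List.Relation.Unary.All as All using (All)
open import Data.List.Relation.Unary.AllPairs using ([]; _∷_)
import Data.List.Relation.Unary.All.Properties as All
open import Data.List.Relation.Unary.Any using (here; there)
open import Data.List.Relation.Unary.Unique.Propositional using (Unique)
import Data.List.Relation.Unary.Unique.Propositional.Properties as Unique
open import Data.List.Relation.Binary.Permutation.Propositional using (↭-sym)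
open import Data.List.Relation.Binary.Permutation.Propositional.Properties
  using (↭-map-inv)
open import Data.List.Membership.Propositional using (_∈_; _∉_)
open import Data.List.Membership.Propositional.Properties using (∈-map⁺; ∈-map⁻)
open import Data.Product using (Σ; _×_; _,_)
open import Data.Empty using (⊥-elim)
open import Relation.Binary.PropositionalEquality

InjectiveOn : {A B : Set} → (A → B) → List A → Set
InjectiveOn f xs = ∀ {x y} → x ∈ xs → y ∈ xs → f x ≡ f y → x ≡ y

Unique-map⁺-on : {A B : Set} {f : A → B} {xs : List A} →
                 InjectiveOn f xs → Unique xs → Unique (map f xs)
Unique-map⁺-on {xs = []}     _   []             = []
Unique-map⁺-on {xs = x ∷ xs} inj (x∉xs ∷ xs-uniq) =
  All.map⁺ (All.tabulate λ y∈xs fx≡fy →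
              All.lookup x∉xs y∈xs (inj (here refl) (there y∈xs) fx≡fy))
  ∷ Unique-map⁺-on (λ x∈ y∈ → inj (there x∈) (there y∈)) xs-uniq

record IsHomomorphism {A B : Set} (0A : A) (_+A_ : A → A → A)
                      (0B : B) (_+B_ : B → B → B) (f : A → B) : Set where
  field
    map-0 : f 0A ≡ 0B
    map-+ : ∀ x y → f (x +A y) ≡ f x +B f y

module _ {A B : Set} {0A : A} {_+A_ : A → A → A} {0B : B} {_+B_ : B → B → B}
         {f : A → B} (hom : IsHomomorphism 0A _+A_ 0B _+B_ f) where

  open IsHomomorphism hom

  lsum-map : ∀ xs → lsum 0B _+B_ (map f xs) ≡ f (lsum 0A _+A_ xs)
  lsum-map []       = sym map-0
  lsum-map (x ∷ xs) = trans (cong (f x +B_) (lsum-map xs)) (sym (map-+ x _))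

  partialSumsFrom-map : ∀ acc xs →
    partialSumsFrom 0B _+B_ (f acc) (map f xs) ≡ map f (partialSumsFrom 0A _+A_ acc xs)
  partialSumsFrom-map acc []       = refl
  partialSumsFrom-map acc (x ∷ xs) rewrite sym (map-+ acc x) =
    cong (f (acc +A x) ∷_) (partialSumsFrom-map (acc +A x) xs)

  partialSums-map : ∀ xs →
    partialSums 0B _+B_ (map f xs) ≡ map f (partialSums 0A _+A_ xs)
  partialSums-map xs rewrite sym map-0 = partialSumsFrom-map 0A xs

  nice-map : ∀ {xs} → InjectiveOn f (0A ∷ lsum 0A _+A_ xs ∷ xs) →
             Nice 0A _+A_ xs → Nice 0B _+B_ (map f xs)
  nice-map {xs} inj (0∉xs , Σxs≢0) = 0∉fxs , fΣxs≢0
    where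
    0∉fxs : 0B ∉ map f xs
    0∉fxs 0∈fxs with _ , x∈xs , 0≡fx ← ∈-map⁻ f 0∈fxs =
      0∉xs (subst (_∈ xs) (inj (there (there x∈xs)) (here refl)
                                (trans (sym 0≡fx) (sym map-0))) x∈xs)
    fΣxs≢0 : lsum 0B _+B_ (map f xs) ≢ 0B
    fΣxs≢0 eq = Σxs≢0 (inj (there (here refl)) (here refl)
                            (trans (sym (lsum-map xs)) (trans eq (sym map-0))))

  alspach-reflect : ∀ {xs} → HasAlspachOrdering 0B _+B_ (map f xs) →
                    HasAlspachOrdering 0A _+A_ xs
  alspach-reflect {xs} (zs , zs↭fxs , zs-sums≢0 , zs-sums-uniq)
    with ys , zs≡fys , xs↭ys ← ↭-map-inv f (↭-sym zs↭fxs) =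
    ys , ↭-sym xs↭ys , ys-sums≢0 , Unique.map⁻ (subst Unique sums≡ zs-sums-uniq)
    where
    sums≡ : partialSums 0B _+B_ zs ≡ map f (partialSums 0A _+A_ ys)
    sums≡ = trans (cong (partialSums 0B _+B_) zs≡fys) (partialSums-map ys)
    ys-sums≢0 : All (_≢ 0A) (partialSums 0A _+A_ ys)
    ys-sums≢0 = All.map (λ fs≢0 s≡0 → fs≢0 (trans (cong f s≡0) map-0))
                        (All.map⁻ (subst (All (_≢ 0B)) sums≡ zs-sums≢0))

difference-of-digits : ∀ (a b x y t : ℤ) →
                       a ℤ.+ t ℤ.* x ≡ b ℤ.+ t ℤ.* y → a - b ≡ t ℤ.* (y - x)
difference-of-digits a b x y t eq = begin
  a - b                                               ≡⟨ regroup a b x y t ⟩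
  (a ℤ.+ t ℤ.* x) - (b ℤ.+ t ℤ.* y) ℤ.+ t ℤ.* (y - x) ≡⟨ cong (λ z → z - (b ℤ.+ t ℤ.* y) ℤ.+ t ℤ.* (y - x)) eq ⟩
  (b ℤ.+ t ℤ.* y) - (b ℤ.+ t ℤ.* y) ℤ.+ t ℤ.* (y - x) ≡⟨ cong (ℤ._+ t ℤ.* (y - x)) (ℤ.+-inverseʳ (b ℤ.+ t ℤ.* y)) ⟩
  + 0 ℤ.+ t ℤ.* (y - x)                               ≡⟨ ℤ.+-identityˡ _ ⟩
  t ℤ.* (y - x)                                       ∎
  where
  open ≡-Reasoning
  regroup : ∀ a b x y t → a - b ≡ (a ℤ.+ t ℤ.* x) - (b ℤ.+ t ℤ.* y) ℤ.+ t ℤ.* (y - x)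
  regroup = solve-∀

digits-injective : ∀ {a b x y : ℤ} {t : ℕ} → ∣ a - b ∣ ℕ.< t →
                   a ℤ.+ + t ℤ.* x ≡ b ℤ.+ + t ℤ.* y → a ≡ b × x ≡ y
digits-injective {a} {b} {x} {y} {t} small eq
  with ∣ y - x ∣ in ∣y-x∣≡r
... | ℕ.zero  = ℤ.i-j≡0⇒i≡j a b a-b≡0 , sym (ℤ.i-j≡0⇒i≡j y x y-x≡0)
  where
  y-x≡0 : y - x ≡ + 0
  y-x≡0 = ℤ.∣i∣≡0⇒i≡0 ∣y-x∣≡r
  a-b≡0 : a - b ≡ + 0
  a-b≡0 = trans (difference-of-digits a b x y (+ t) eq)
                (trans (cong (+ t ℤ.*_) y-x≡0) (ℤ.*-zeroʳ (+ t)))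
... | ℕ.suc r = ⊥-elim (ℕ.<⇒≱ small (begin
  t                     ≤⟨ ℕ.m≤m*n t (ℕ.suc r) ⟩
  t ℕ.* ℕ.suc r         ≡⟨ cong (t ℕ.*_) ∣y-x∣≡r ⟨
  t ℕ.* ∣ y - x ∣       ≡⟨ ℤ.abs-* (+ t) (y - x) ⟨
  ∣ + t ℤ.* (y - x) ∣   ≡⟨ cong ∣_∣ (difference-of-digits a b x y (+ t) eq) ⟨
  ∣ a - b ∣             ∎))
  where open ℕ.≤-Reasoning

IsLinearForm : (n : ℕ) → (Vec ℤ n → ℤ) → Set
IsLinearForm n = IsHomomorphism (zeroⁿ n) _+ⁿ_ (+ 0) ℤ._+_

horner : ∀ {m} → ℕ → (Vec ℤ m → ℤ) → Vec ℤ (ℕ.suc m) → ℤ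
horner t ψ (a ∷ w) = a ℤ.+ + t ℤ.* ψ w

horner-isLinearForm : ∀ {m} t {ψ : Vec ℤ m → ℤ} →
                      IsLinearForm m ψ → IsLinearForm (ℕ.suc m) (horner t ψ)
horner-isLinearForm {m} t {ψ} lin = record { map-0 = horner-0 ; map-+ = horner-+ }
  where
  open IsHomomorphism lin
  horner-0 : horner t ψ (zeroⁿ (ℕ.suc m)) ≡ + 0
  horner-0 rewrite map-0 = trans (ℤ.+-identityˡ _) (ℤ.*-zeroʳ (+ t))
  horner-+ : ∀ u v → horner t ψ (u +ⁿ v) ≡ horner t ψ u ℤ.+ horner t ψ v
  horner-+ (a ∷ w) (b ∷ w') rewrite map-+ w w' = regroup a b (ψ w) (ψ w') (+ t)
    where
    regroup : ∀ a b x y t → (a ℤ.+ b) ℤ.+ t ℤ.* (x ℤ.+ y) ≡ (a ℤ.+ t ℤ.* x) ℤ.+ (b ℤ.+ t ℤ.* y)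
    regroup = solve-∀

horner-injectiveOn : ∀ {m} {t} {ψ : Vec ℤ m → ℤ} (L : List (Vec ℤ (ℕ.suc m))) →
                     (∀ {u v} → u ∈ L → v ∈ L → ∣ head u - head v ∣ ℕ.< t) →
                     InjectiveOn ψ (map tail L) → InjectiveOn (horner t ψ) L
horner-injectiveOn L small inj {a ∷ w} {b ∷ w'} u∈L v∈L eq
  with a≡b , ψw≡ψw' ← digits-injective (small u∈L v∈L) eq =
  cong₂ _∷_ a≡b (inj (∈-map⁺ tail u∈L) (∈-map⁺ tail v∈L) ψw≡ψw')

headBound : ∀ {m} → List (Vec ℤ (ℕ.suc m)) → ℕ
headBound L = max 0 (map (λ u → ∣ head u ∣) L)

∣head∣≤headBound : ∀ {m} {L : List (Vec ℤ (ℕ.suc m))} {u} → u ∈ L → ∣ head u ∣ ≤ headBound L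
∣head∣≤headBound {L = L} u∈L =
  All.lookup (xs≤max 0 (map (λ u → ∣ head u ∣) L)) (∈-map⁺ (λ u → ∣ head u ∣) u∈L)

separatingLinearForm : ∀ n (L : List (Vec ℤ n)) →
                       Σ (Vec ℤ n → ℤ) λ ψ → IsLinearForm n ψ × InjectiveOn ψ L
separatingLinearForm ℕ.zero L =
  (λ _ → + 0) , record { map-0 = refl ; map-+ = λ _ _ → refl } , λ { {[]} {[]} _ _ _ → refl }
separatingLinearForm (ℕ.suc m) L
  with ψ , lin , inj ← separatingLinearForm m (map tail L) =
  horner t ψ , horner-isLinearForm t lin , horner-injectiveOn L small inj
  where
  t : ℕ
  t = ℕ.suc (headBound L ℕ.+ headBound L)
  small : ∀ {u v} → u ∈ L → v ∈ L → ∣ head u - head v ∣ ℕ.< t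
  small {u} {v} u∈L v∈L = ℕ.s≤s (ℕ.≤-trans (ℤ.∣i-j∣≤∣i∣+∣j∣ (head u) (head v))
                                           (ℕ.+-mono-≤ (∣head∣≤headBound u∈L) (∣head∣≤headBound v∈L)))

proposition2p3 : (k : ℕ) → 1 ≤ k → AllNiceAdmitAlspachℤ k →
    (n : ℕ) → 2 ≤ n → AllNiceAdmitAlspachℤⁿ n k
proposition2p3 k _ alspachℤ n _ xs xs-uniq |xs|≡k xs-nice
  with ψ , lin , inj ← separatingLinearForm n (zeroⁿ n ∷ lsum (zeroⁿ n) _+ⁿ_ xs ∷ xs) =
  alspach-reflect lin (alspachℤ (map ψ xs)
    (Unique-map⁺-on (λ x∈ y∈ → inj (there (there x∈)) (there (there y∈))) xs-uniq)
    (trans (length-map ψ xs) |xs|≡k)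
    (nice-map lin inj xs-nice))
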